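{- Let $\mathcal{F}$ be a class of graphs and $\ell$ a positive integer. Let $\mathcal{F}'$ be the class of graphs $G$ such that $G=H^\ell$ for some $H\in\mathcal{F}$. Then $\operatorname{ad}(\mathcal{F}')\le\operatorname{ad}(\mathcal{F})$.
   Context: All graphs are finite. $H^\ell$ is the graph obtained from $H$ by adding an edge between every two distinct vertices at distance at most $\ell$ in $H$. For a graph $G$ and $x,y\in V(G)$, $d_G(x,y)$ is the minimum number of edges of a path in $G$ between $x$ and $y$. For a nonnegative integer $n$, an $n$-dimensional control function for a class $\mathcal{F}$ of graphs is a function $f:\mathbb{R}^+\to\mathbb{R}^+$ such that for every $G\in\mathcal{F}$ and every real $r>0$ there exist collections $\mathcal{U}_1,\dots,\mathcal{U}_{n+1}$ of subsets of $V(G)$ covering $V(G)$, such that for each $i$, whenever $U\neq U'$ are in $\mathcal{U}_i$ and $x\in U$, $x'\in U'$, we have $d_G(x,x')>r$, and whenever $x,x'$ lie in a common $U\in\mathcal{U}_i$ we have $d_G(x,x')\le f(r)$. $\operatorname{ad}(\mathcal{F})$ is the minimum $n$ for which there is a common $n$-dimensional control function for all graphs in $\mathcal{F}$.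
   Formalization: Control functions send positive rationals to positive rationals, and the scale r ranges over the positive rationals, in place of $\mathbb{R}^+$ and every real $r>0$. -}

module Defs where

open import Data.Nat using (ℕ; zero; suc)
import Data.Nat
open import Data.Fin using (Fin)
open import Data.Fin.Subset using (Subset; _∈_)
open import Data.List using (List)
import Data.List.Membership.Propositional as LM
open import Data.Integer using (+_)
open import Data.Rational using (ℚ; _/_; _≤_; _<_; 0ℚ)
open import Data.Product using (Σ; ∃; _×_; Σ-syntax; ∃-syntax)
open import Relation.Binary.PropositionalEquality using (_≡_; _≢_)
open import Relation.Nullary using (¬_)

record Graph : Set₁ where
  field
    size : ℕ
    Adj  : Fin size → Fin size → Set
    sym  : ∀ {x y} → Adj x y → Adj y x
    irr  : ∀ {x} → ¬ Adj x x

open Graph public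

GraphClass : Set₂
GraphClass = Graph → Set₁

data Walk (G : Graph) : Fin (size G) → Fin (size G) → ℕ → Set where
  here : ∀ {x} → Walk G x x 0
  step : ∀ {x y z k} → Adj G x y → Walk G y z k → Walk G x z (suc k)

ℕ→ℚ : ℕ → ℚ
ℕ→ℚ k = (+ k) / 1

DistLeℕ : (G : Graph) → Fin (size G) → Fin (size G) → ℕ → Set
DistLeℕ G x y ℓ = ∃[ k ] (Walk G x y k × k Data.Nat.≤ ℓ)

-- d_G(x,y) ≤ t  for a rational t (d may be ∞ when disconnected).
DistLe : (G : Graph) → Fin (size G) → Fin (size G) → ℚ → Set
DistLe G x y t = ∃[ k ] (Walk G x y k × ℕ→ℚ k ≤ t)

DistGt : (G : Graph) → Fin (size G) → Fin (size G) → ℚ → Set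
DistGt G x y t = ¬ DistLe G x y t

IsPower : (G H : Graph) → ℕ → Set
IsPower G H ℓ =
  Σ (size G ≡ size H) λ { _≡_.refl →
    ∀ (x y : Fin (size G)) →
      (Adj G x y → (x ≢ y × DistLeℕ H x y ℓ)) ×
      ((x ≢ y × DistLeℕ H x y ℓ) → Adj G x y) }

PowerClass : GraphClass → ℕ → GraphClass
PowerClass F ℓ G = Σ[ H ∈ Graph ] (F H × IsPower G H ℓ)

-- Functions ℝ⁺ → ℝ⁺ rendered as ℚ → ℚ, positive on positive inputs.
PosFun : Set
PosFun = Σ[ f ∈ (ℚ → ℚ) ] (∀ r → 0ℚ < r → 0ℚ < f r)

IsControlCover : (G : Graph) (n : ℕ) (f : ℚ → ℚ) (r : ℚ) →
                 (Fin (suc n) → List (Subset (size G))) → Set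
IsControlCover G n f r 𝒰 =
  (∀ (x : Fin (size G)) → ∃[ i ] ∃[ U ] (U LM.∈ 𝒰 i × x ∈ U)) ×
  (∀ i U U' → U LM.∈ 𝒰 i → U' LM.∈ 𝒰 i → U ≢ U' →
     ∀ x x' → x ∈ U → x' ∈ U' → DistGt G x x' r) ×
  (∀ i U → U LM.∈ 𝒰 i → ∀ x x' → x ∈ U → x' ∈ U → DistLe G x x' (f r))

IsControlFunction : GraphClass → ℕ → (ℚ → ℚ) → Set₁
IsControlFunction F n f =
  ∀ G → F G → ∀ r → 0ℚ < r →
    ∃[ 𝒰 ] IsControlCover G n f r 𝒰

AdLe : GraphClass → ℕ → Set₁
AdLe F n = Σ[ f ∈ PosFun ] IsControlFunction F n (Data.Product.proj₁ f)
  where import Data.Product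

module Submission where

-- Let G = H^ℓ with ℓ ≥ 1. On the common vertex set the two metrics are
-- comparable:   d_G(x,y) ≤ d_H(x,y) ≤ ℓ · d_G(x,y).
-- The first inequality holds because every edge of H is an edge of G; the
-- second because every edge of G joins vertices at H-distance at most ℓ, so a
-- G-walk of length k unfolds into an H-walk of length at most ℓk.
-- Consequently, if 𝒰 is an (ℓr)-separated cover of H whose pieces have
-- H-diameter at most f(ℓr), then the same 𝒰 is r-separated in G and its pieces
-- have G-diameter at most f(ℓr). So r ↦ f(ℓr) is a control function for the
-- class of ℓ-th powers whenever f is one for the original class.

open import Defs
open import Data.Nat using (ℕ; _≤_)
open import Data.Nat as ℕ using (suc; z≤n)
import Data.Nat.Properties as ℕP
open import Data.Integer as ℤ using (+_)
import Data.Integer.Properties as ℤP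
open import Data.Rational as ℚ using (ℚ; mkℚ; 0ℚ; *≤*)
import Data.Rational.Properties as ℚP
open import Data.Nat.Coprimality as Coprimality using (1-coprimeTo)
open import Data.Fin using (Fin)
open import Data.Product using (_×_; _,_; proj₁; proj₂; ∃-syntax)
open import Relation.Binary.PropositionalEquality using (_≡_; refl; cong; subst; subst₂)
  renaming (sym to ≡-sym)
open import Relation.Nullary using (¬_)

ℕ→ℚ-as-mkℚ : ∀ k → ℕ→ℚ k ≡ mkℚ (+ k) 0 (Coprimality.sym (1-coprimeTo k))
ℕ→ℚ-as-mkℚ k = ℚP.normalize-coprime {k} {0} (Coprimality.sym (1-coprimeTo k))

ℕ→ℚ-* : ∀ a b → ℕ→ℚ (a ℕ.* b) ≡ ℕ→ℚ a ℚ.* ℕ→ℚ b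
ℕ→ℚ-* a b rewrite ℕ→ℚ-as-mkℚ a | ℕ→ℚ-as-mkℚ b = cong (ℚ._/ 1) (ℤP.pos-* a b)

ℕ→ℚ-mono-≤ : ∀ {m n} → m ℕ.≤ n → ℕ→ℚ m ℚ.≤ ℕ→ℚ n
ℕ→ℚ-mono-≤ {m} {n} m≤n rewrite ℕ→ℚ-as-mkℚ m | ℕ→ℚ-as-mkℚ n =
  *≤* (subst₂ ℤ._≤_ (≡-sym (ℤP.*-identityʳ (+ m))) (≡-sym (ℤP.*-identityʳ (+ n)))
                   (ℤ.+≤+ m≤n))

-- Scaling a positive radius by a positive integer keeps it positive; this is
-- what makes r ↦ f(ℓr) again a positive function.
scale-pos : ∀ ℓ → 1 ≤ ℓ → ∀ r → 0ℚ ℚ.< r → 0ℚ ℚ.< ℕ→ℚ ℓ ℚ.* r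
scale-pos (suc l) _ r 0<r =
  ℚP.positive⁻¹ _ {{ℚP.pos*pos⇒pos (ℕ→ℚ (suc l)) {{ℚP.normalize-pos (suc l) 1}}
                                  r {{ℚ.positive 0<r}}}}

scale-≤ : ∀ ℓ k {t} → ℕ→ℚ k ℚ.≤ t → ℕ→ℚ (ℓ ℕ.* k) ℚ.≤ ℕ→ℚ ℓ ℚ.* t
scale-≤ ℓ k {t} k≤t =
  subst (ℚ._≤ ℕ→ℚ ℓ ℚ.* t) (≡-sym (ℕ→ℚ-* ℓ k))
        (ℚP.*-monoˡ-≤-nonNeg (ℕ→ℚ ℓ) {{ℚP.normalize-nonNeg ℓ 1}} k≤t)

_++ʷ_ : ∀ {H : Graph} {x y z a b} → Walk H x y a → Walk H y z b → Walk H x z (a ℕ.+ b)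
here       ++ʷ w = w
step e v   ++ʷ w = step e (v ++ʷ w)

onVerticesOf : (H : Graph) (A : Fin (size H) → Fin (size H) → Set) →
               (∀ {x y} → A x y → A y x) → (∀ {x} → ¬ A x x) → Graph
onVerticesOf H A A-sym A-irr =
  record { size = size H ; Adj = A ; sym = A-sym ; irr = A-irr }

cover-transfer :
  ∀ (H : Graph) {A : Fin (size H) → Fin (size H) → Set}
  {A-sym : ∀ {x y} → A x y → A y x} {A-irr : ∀ {x} → ¬ A x x} (c : ℚ) →
  let G = onVerticesOf H A A-sym A-irr in
  (∀ {x y t} → DistLe G x y t → DistLe H x y (c ℚ.* t)) →
  (∀ {x y t} → DistLe H x y t → DistLe G x y t) →
  ∀ {n f r 𝒰} → IsControlCover H n f (c ℚ.* r) 𝒰 →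
  IsControlCover G n (λ s → f (c ℚ.* s)) r 𝒰
cover-transfer H c G≤→H≤ H≤→G≤ (covers , separated , bounded) =
  covers ,
  (λ i U U' U∈ U'∈ U≢U' x x' x∈U x'∈U' dG≤r →
     separated i U U' U∈ U'∈ U≢U' x x' x∈U x'∈U' (G≤→H≤ dG≤r)) ,
  (λ i U U∈ x x' x∈U x'∈U → H≤→G≤ (bounded i U U∈ x x' x∈U x'∈U))

module Power (H : Graph) (ℓ : ℕ) (1≤ℓ : 1 ≤ ℓ)
  {A : Fin (size H) → Fin (size H) → Set}
  {A-sym : ∀ {x y} → A x y → A y x} {A-irr : ∀ {x} → ¬ A x x}
  (power : ∀ (x y : Fin (size H)) →
      (A x y → (¬ x ≡ y × DistLeℕ H x y ℓ)) ×
      ((¬ x ≡ y × DistLeℕ H x y ℓ) → A x y)) where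

  G : Graph
  G = onVerticesOf H A A-sym A-irr

  -- Each G-edge is replaced by an H-walk of length ≤ ℓ.
  unfold-walk : ∀ {x y k} → Walk G x y k → ∃[ m ] (Walk H x y m × m ≤ ℓ ℕ.* k)
  unfold-walk here = 0 , here , z≤n
  unfold-walk {x} {k = suc k} (step {y = y} e w)
    with proj₂ (proj₁ (power x y) e) | unfold-walk w
  ... | a , edge-walk , a≤ℓ | b , rest , b≤ℓk =
    a ℕ.+ b , edge-walk ++ʷ rest ,
    subst (a ℕ.+ b ≤_) (≡-sym (ℕP.*-suc ℓ k)) (ℕP.+-mono-≤ a≤ℓ b≤ℓk)

  -- Each H-edge joins distinct vertices at H-distance 1 ≤ ℓ, hence is a G-edge.
  lift-walk : ∀ {x y k} → Walk H x y k → Walk G x y k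
  lift-walk here = here
  lift-walk {x} (step {y = y} e w) =
    step (proj₂ (power x y) (x≢y , 1 , step e here , 1≤ℓ)) (lift-walk w)
    where
    x≢y : ¬ x ≡ y
    x≢y refl = irr H e

  dist-unfold : ∀ {x y t} → DistLe G x y t → DistLe H x y (ℕ→ℚ ℓ ℚ.* t)
  dist-unfold (k , w , k≤t) with unfold-walk w
  ... | m , w' , m≤ℓk = m , w' , ℚP.≤-trans (ℕ→ℚ-mono-≤ m≤ℓk) (scale-≤ ℓ k k≤t)

  dist-lift : ∀ {x y t} → DistLe H x y t → DistLe G x y t
  dist-lift (k , w , k≤t) = k , lift-walk w , k≤t

corollary1p11 : (F : GraphClass) (ℓ : ℕ) → 1 ≤ ℓ →
    ∀ n → AdLe F n → AdLe (PowerClass F ℓ) n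
corollary1p11 F ℓ 1≤ℓ n ((f , f-pos) , control) =
  (f∘ℓ , λ r 0<r → f-pos _ (scale-pos ℓ 1≤ℓ r 0<r)) , control-power
  where
  f∘ℓ : ℚ → ℚ
  f∘ℓ r = f (ℕ→ℚ ℓ ℚ.* r)

  control-power : IsControlFunction (PowerClass F ℓ) n f∘ℓ
  control-power (record { size = .(size H) }) (H , H∈F , refl , power) r 0<r
    with control H H∈F (ℕ→ℚ ℓ ℚ.* r) (scale-pos ℓ 1≤ℓ r 0<r)
  ... | 𝒰 , cover = 𝒰 , cover-transfer H (ℕ→ℚ ℓ) dist-unfold dist-lift {f = f} cover
    where open Power H ℓ 1≤ℓ power
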